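{- Let $n\ge2$, let $\lambda$ be a proper permutation, and let $g$ be an embedding into $\pi_n$ of some permutation $\tau$ with $\lambda\le\tau\le\pi_n$. Then the rightmost embedding of $\lambda$ in $g$ is the pointwise maximum of all the embeddings of $\lambda$ into $\pi_n$ compatible with $g$.
   Context: Permutations of size $m$ are bijections of $[m]$ written as value sequences. An embedding of $\sigma\in\mathcal{S}_k$ into $\pi\in\mathcal{S}_N$ is a strictly increasing $f\colon[k]\to[N]$ with $\pi(f(1)),\dots,\pi(f(k))$ order-isomorphic to $\sigma$; $\mathrm{Img}(f)$ is its image; $\sigma\le\pi$ iff one exists. For $n\ge1$, $\pi_n\in\mathcal{S}_{2n+2}$ is given by $\pi_n(1)=n+1$, $\pi_n(2i)=i$ and $\pi_n(2i+1)=n+2+i$ for $1\le i\le n$, $\pi_n(2n+2)=n+2$. An inverse descent of $\lambda$ is a pair $i<j$ with $\lambda(i)=\lambda(j)+1$. If $\lambda$ has exactly one inverse descent, at $i<j$, then $\lambda(k)$ is a top element if $\lambda(k)\ge\lambda(i)$ and a bottom element if $\lambda(k)\le\lambda(j)$; a top (bottom) repetition is a pair of consecutive elements both top (bottom). A permutation $\lambda$ with $21\le\lambda<\pi_n$ of size $m$ is proper if: (1) it has exactly one inverse descent; (2) $\lambda(1),\lambda(m-1)$ are top elements and $\lambda(2),\lambda(m)$ are bottom elements (for $m=2$, $\lambda=21$); (3) it has at most one top repetition and at most one bottom repetition, and if both, the top repetition is to the left of the bottom one. An embedding $f$ of $\lambda$ into $\pi_n$ is compatible with an embedding $g$ into $\pi_n$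 if $\mathrm{Img}(f)\subseteq\mathrm{Img}(g)$. The lexicographic order $<_L$ on embeddings of $\lambda$ into $\pi_n$: $f'<_L f$ if, for the smallest $i$ with $f(i)\ne f'(i)$, we have $f'(i)<f(i)$. The rightmost embedding of $\lambda$ in $g$ is the $<_L$-maximum among embeddings of $\lambda$ compatible with $g$. The pointwise maximum of maps $f_1,\dots,f_r\colon[m]\to[2n+2]$ is $i\mapsto\max_s f_s(i)$. -}

module Defs where

open import Data.Nat using (ℕ; zero; suc; _+_; _∸_; _≤_; _<_; _≟_; _%_; _/_)
open import Data.Fin using (Fin; toℕ; cast)
open import Data.Product using (Σ; ∃; _×_; _,_; proj₁)
open import Data.Sum using (_⊎_)
open import Relation.Binary.PropositionalEquality using (_≡_; _≢_)
open import Relation.Nullary using (¬_; yes; no)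
open import Function.Bundles using (_⇔_)
open import Function.Definitions using (Bijective)

-- Value sequences of length m (values compared in ℕ; only relative order matters
-- for pattern containment).
Seq : ℕ → Set
Seq m = Fin m → ℕ

-- Permutations of size m: bijections of Fin m (0-indexed version of [m]).
record Perm (m : ℕ) : Set where
  constructor perm
  field
    fun : Fin m → Fin m
    bij : Bijective _≡_ _≡_ fun

open Perm public

⟦_⟧ : {m : ℕ} → Perm m → Seq m
⟦ p ⟧ i = toℕ (fun p i)

-- π_n in value-sequence form (1-indexed values, positions given 0-indexed q = p - 1):
-- π_n(1) = n+1, π_n(2i) = i, π_n(2i+1) = n+2+i, π_n(2n+2) = n+2.
piVal : ℕ → ℕ → ℕ
piVal n zero = suc n
piVal n q@(suc _) with q ≟ suc (n + n)
... | yes _ = suc (suc n)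
... | no _ with q % 2
...   | 1 = (q + 1) / 2
...   | _ = suc (suc n) + q / 2

πseq : (n : ℕ) → Seq (suc (suc (n + n)))
πseq n x = piVal n (toℕ x)

seq21 : Seq 2
seq21 x = 1 ∸ toℕ x

record Embedding {k N : ℕ} (σ : Seq k) (π : Seq N) : Set where
  constructor emb
  field
    map      : Fin k → Fin N
    strict   : ∀ i j → toℕ i < toℕ j → toℕ (map i) < toℕ (map j)
    orderIso : ∀ i j → (σ i < σ j) ⇔ (π (map i) < π (map j))

open Embedding public

_≼_ : {k N : ℕ} → Seq k → Seq N → Set
σ ≼ π = Embedding σ π

SeqEq : {k N : ℕ} → Seq k → Seq N → Set
SeqEq {k} {N} σ π = Σ (k ≡ N) λ e → ∀ i → σ i ≡ π (cast e i)

_≺_ : {k N : ℕ} → Seq k → Seq N → Set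
σ ≺ π = (σ ≼ π) × ¬ SeqEq σ π

InvDescent : {m : ℕ} → Seq m → Fin m → Fin m → Set
InvDescent λs i j = (toℕ i < toℕ j) × (λs i ≡ suc (λs j))

module _ {m : ℕ} (λs : Seq m) (i j : Fin m) where
  Top : Fin m → Set
  Top p = λs i ≤ λs p

  Bottom : Fin m → Set
  Bottom p = λs p ≤ λs j

  TopRep : Fin m → Fin m → Set
  TopRep p q = (suc (toℕ p) ≡ toℕ q) × Top p × Top q

  BotRep : Fin m → Fin m → Set
  BotRep p q = (suc (toℕ p) ≡ toℕ q) × Bottom p × Bottom q

  ProperAt : Set
  ProperAt =
      InvDescent λs i j
    × (∀ i' j' → InvDescent λs i' j' → (i' ≡ i) × (j' ≡ j))
    -- (2) λ(1), λ(m-1) top; λ(2), λ(m) bottom  (0-indexed positions 0, m-2 / 1, m-1)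
    × (∀ p → (toℕ p ≡ 0 ⊎ toℕ p ≡ m ∸ 2) → Top p)
    × (∀ p → (toℕ p ≡ 1 ⊎ toℕ p ≡ m ∸ 1) → Bottom p)
    × (∀ p q p' q' → TopRep p q → TopRep p' q' → p ≡ p')
    × (∀ p q p' q' → BotRep p q → BotRep p' q' → p ≡ p')
    × (∀ p q p' q' → TopRep p q → BotRep p' q' → toℕ p < toℕ p')

-- proper permutation (for a given n, since the definition requires 21 ≤ λ < π_n)
Proper : (n : ℕ) {m : ℕ} → Perm m → Set
Proper n {m} λp =
  (seq21 ≼ ⟦ λp ⟧) × (⟦ λp ⟧ ≺ πseq n) × ∃ λ i → ∃ λ j → ProperAt ⟦ λp ⟧ i j

Compatible : {k t N : ℕ} {σ : Seq k} {τ : Seq t} {π : Seq N} →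
             Embedding σ π → Embedding τ π → Set
Compatible f g = ∀ i → ∃ λ j → map f i ≡ map g j

_<L_ : {k N : ℕ} {σ : Seq k} {π : Seq N} → Embedding σ π → Embedding σ π → Set
f' <L f = ∃ λ i → (∀ j → toℕ j < toℕ i → map f' j ≡ map f j)
                 × (toℕ (map f' i) < toℕ (map f i))

_≤L_ : {k N : ℕ} {σ : Seq k} {π : Seq N} → Embedding σ π → Embedding σ π → Set
f' ≤L f = (∀ i → map f' i ≡ map f i) ⊎ (f' <L f)

IsRightmost : {k t N : ℕ} {σ : Seq k} {τ : Seq t} {π : Seq N} →
              Embedding τ π → Embedding σ π → Set
IsRightmost {σ = σ} {π = π} g h =
  Compatible h g × ((f : Embedding σ π) → Compatible f g → f ≤L h)

IsPointwiseMax : {k t N : ℕ} {σ : Seq k} {τ : Seq t} {π : Seq N} →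
                 Embedding τ π → Embedding σ π → Set
IsPointwiseMax {σ = σ} {π = π} g h =
  ∀ i → (Σ (Embedding σ π) λ f → Compatible f g × map f i ≡ map h i)
      × ((f : Embedding σ π) → Compatible f g → toℕ (map f i) ≤ toℕ (map h i))

-- In π_n, read with 0-indexed positions, the even positions carry values ≥ n + 1 and
-- the odd positions values ≤ n + 2, increasingly in both cases. An embedding of a
-- proper λ must send its top elements to even positions and its bottom elements to odd
-- ones: otherwise the inverse descent, the first letter (top) or the last letter
-- (bottom) could not be realised. So any two embeddings of λ place each letter on
-- positions of equal parity, where position order agrees with value order, and hence
-- their pointwise maximum is again an embedding, compatible with g whenever both are.
-- If some compatible f exceeded the rightmost h at a letter, the maximum of f and h
-- would be lexicographically larger than h.
module Submission where

open import Defs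
open import Data.Nat using (ℕ; zero; suc; _+_; _*_; _∸_; _≤_; _<_; _≟_; _%_; _/_; _≤?_; z≤n; s≤s; s≤s⁻¹)
open import Data.Nat.Properties
open import Data.Nat.DivMod using (m*n/n≡m; m*n%n≡0; [m+kn]%n≡m%n)
open import Data.Fin using (Fin; toℕ; fromℕ<) renaming (zero to fzero; suc to fsuc)
open import Data.Fin.Properties using (toℕ<n; toℕ≤pred[n]; toℕ-fromℕ<; toℕ-injective)
open import Data.Product using (∃; _×_; _,_; proj₁; proj₂)
open import Data.Sum using (_⊎_; inj₁; inj₂)
open import Data.Empty using (⊥; ⊥-elim)
open import Relation.Binary using (tri<; tri≈; tri>)
open import Relation.Binary.PropositionalEquality
open import Relation.Nullary using (¬_; yes; no; contradiction)
open import Function.Base using (_∘_)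
open import Function.Bundles using (Equivalence; mk⇔)
open import Function.Definitions using (Injective)

Even Odd : ℕ → Set
Even q = ∃ λ k → q ≡ k + k
Odd  q = ∃ λ k → q ≡ suc (k + k)

SameParity : ℕ → ℕ → Set
SameParity p q = (Even p × Even q) ⊎ (Odd p × Odd q)

even⊎odd : ∀ q → Even q ⊎ Odd q
even⊎odd zero = inj₁ (zero , refl)
even⊎odd (suc q) with even⊎odd q
... | inj₁ (k , refl) = inj₂ (k , refl)
... | inj₂ (k , refl) = inj₁ (suc k , cong suc (sym (+-suc k k)))

double≡2* : ∀ k → k + k ≡ 2 * k
double≡2* k = cong (k +_) (sym (+-identityʳ k))

double≡*2 : ∀ k → k + k ≡ k * 2
double≡*2 k = trans (double≡2* k) (*-comm 2 k)

double-%2 : ∀ k → (k + k) % 2 ≡ 0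
double-%2 k = trans (cong (_% 2) (double≡*2 k)) (m*n%n≡0 k 2)

suc-double-%2 : ∀ k → suc (k + k) % 2 ≡ 1
suc-double-%2 k = trans (cong (λ x → suc x % 2) (double≡*2 k)) ([m+kn]%n≡m%n 1 k 2)

double-/2 : ∀ k → (k + k) / 2 ≡ k
double-/2 k = trans (cong (_/ 2) (double≡*2 k)) (m*n/n≡m k 2)

suc-double+1 : ∀ k → suc (k + k) + 1 ≡ suc k + suc k
suc-double+1 k = trans (+-comm (suc (k + k)) 1) (cong suc (sym (+-suc k k)))

double≢suc-double : ∀ a b → a + a ≢ suc (b + b)
double≢suc-double a b e = even≢odd a b (trans (sym (double≡2* a)) (trans e (cong suc (double≡2* b))))

double-cancel-≤ : ∀ {k k'} → k + k ≤ k' + k' → k ≤ k'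
double-cancel-≤ le = ≮⇒≥ λ k'<k → <⇒≱ (+-mono-< k'<k k'<k) le

double-cancel-< : ∀ {k k'} → k + k < k' + k' → k < k'
double-cancel-< lt = ≰⇒> λ k'≤k → <⇒≱ lt (+-mono-≤ k'≤k k'≤k)

piVal-double : ∀ n k → piVal n (suc k + suc k) ≡ suc (suc (suc (n + k)))
piVal-double n k with suc k + suc k ≟ suc (n + n)
... | yes e = ⊥-elim (double≢suc-double (suc k) n e)
... | no _ with (suc k + suc k) % 2 | double-%2 (suc k)
...   | .0 | refl = trans (cong (suc (suc n) +_) (double-/2 (suc k))) (cong (suc ∘ suc) (+-suc n k))

piVal-odd : ∀ n k → k < n → piVal n (suc (k + k)) ≡ suc k
piVal-odd n k k<n with suc (k + k) ≟ suc (n + n)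
... | yes e = contradiction (double-cancel-≤ (≤-reflexive (sym (suc-injective e)))) (<⇒≱ k<n)
... | no _ with suc (k + k) % 2 | suc-double-%2 k
...   | .1 | refl = trans (cong (_/ 2) (suc-double+1 k)) (double-/2 (suc k))

piVal-last : ∀ n → piVal n (suc (n + n)) ≡ suc (suc n)
piVal-last n with suc (n + n) ≟ suc (n + n)
... | yes _ = refl
... | no ≢ = contradiction refl ≢

piVal-even-≥ : ∀ n {q} → Even q → suc n ≤ piVal n q
piVal-even-≥ n (zero , refl) = ≤-refl
piVal-even-≥ n (suc k , refl) rewrite piVal-double n k = m≤n⇒m≤1+n (m≤n⇒m≤1+n (s≤s (m≤m+n n k)))

piVal-even-pos-≥ : ∀ n {q} → Even q → 0 < q → 3 + n ≤ piVal n q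
piVal-even-pos-≥ n (suc k , refl) _ rewrite piVal-double n k = s≤s (s≤s (s≤s (m≤m+n n k)))

piVal-odd-inner-≤ : ∀ n {q} → Odd q → q < suc (n + n) → piVal n q ≤ n
piVal-odd-inner-≤ n (k , refl) lt = subst (_≤ n) (sym (piVal-odd n k k<n)) k<n
  where
  k<n : k < n
  k<n = double-cancel-< (s≤s⁻¹ lt)

piVal-odd-≤ : ∀ n {q} → Odd q → q ≤ suc (n + n) → piVal n q ≤ 2 + n
piVal-odd-≤ n (k , refl) le with m≤n⇒m<n∨m≡n le
... | inj₁ lt = m≤n⇒m≤1+n (m≤n⇒m≤1+n (piVal-odd-inner-≤ n (k , refl) lt))
... | inj₂ e = ≤-reflexive (trans (cong (piVal n) e) (piVal-last n))

piVal-mono-sameParity : ∀ n {p q} → SameParity p q → p ≤ q → q ≤ suc (n + n) →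
                        piVal n p ≤ piVal n q
piVal-mono-sameParity n (inj₁ ((k , refl) , (k' , refl))) p≤q _ =
  even-mono (double-cancel-≤ {k} {k'} p≤q)
  where
  even-mono : ∀ {k k'} → k ≤ k' → piVal n (k + k) ≤ piVal n (k' + k')
  even-mono {zero} {k'} _ = piVal-even-≥ n (k' , refl)
  even-mono {suc k} {suc k'} (s≤s k≤k') rewrite piVal-double n k | piVal-double n k' =
    s≤s (s≤s (s≤s (+-monoʳ-≤ n k≤k')))
piVal-mono-sameParity n (inj₂ ((k , refl) , (k' , refl))) p≤q q≤ with m≤n⇒m<n∨m≡n q≤
... | inj₁ q<
      rewrite piVal-odd n k (double-cancel-< (s≤s⁻¹ (≤-<-trans p≤q q<)))
            | piVal-odd n k' (double-cancel-< (s≤s⁻¹ q<)) = s≤s (double-cancel-≤ (s≤s⁻¹ p≤q))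
... | inj₂ e = ≤-trans (piVal-odd-≤ n (k , refl) (≤-trans p≤q q≤))
                    (≤-reflexive (sym (trans (cong (piVal n) e) (piVal-last n))))

module _ {k N : ℕ} {σ : Seq k} {π : Seq N} (f : Embedding σ π) where

  embedding-< : ∀ {a b} → σ a < σ b → π (map f a) < π (map f b)
  embedding-< {a} {b} = Equivalence.to (orderIso f a b)

  embedding-≤ : Injective _≡_ _≡_ σ → ∀ {a b} → σ a ≤ σ b → π (map f a) ≤ π (map f b)
  embedding-≤ σ-injective σa≤σb with m≤n⇒m<n∨m≡n σa≤σb
  ... | inj₁ σa<σb = <⇒≤ (embedding-< σa<σb)
  ... | inj₂ σa≡σb rewrite σ-injective σa≡σb = ≤-refl

  embedding-zero : ∀ {a} → toℕ (map f a) ≡ 0 → toℕ a ≡ 0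
  embedding-zero {fzero} _ = refl
  embedding-zero {fsuc a} fa≡0 =
    contradiction (subst (toℕ (map f fzero) <_) fa≡0 (strict f fzero (fsuc a) (s≤s z≤n))) λ ()

  embedding-last : ∀ {a} → suc (toℕ (map f a)) ≡ N → suc (toℕ a) ≡ k
  embedding-last {a} fa-last = ≤-antisym (toℕ<n a) (≮⇒≥ λ a+1<k →
    let a+1 = fromℕ< a+1<k
        fa<fa+1 = strict f a a+1 (≤-reflexive (sym (toℕ-fromℕ< a+1<k)))
    in <⇒≱ (toℕ<n (map f a+1)) (subst (_≤ toℕ (map f a+1)) fa-last fa<fa+1))

_⊔ᶠ_ : ∀ {N} → Fin N → Fin N → Fin N
x ⊔ᶠ y with toℕ x ≤? toℕ y
... | yes _ = y
... | no  _ = x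

⊔ᶠ-cases : ∀ {N} (x y : Fin N) →
           (x ⊔ᶠ y ≡ x × toℕ y ≤ toℕ x) ⊎ (x ⊔ᶠ y ≡ y × toℕ x ≤ toℕ y)
⊔ᶠ-cases x y with toℕ x ≤? toℕ y
... | yes x≤y = inj₂ (refl , x≤y)
... | no  x≰y = inj₁ (refl , <⇒≤ (≰⇒> x≰y))

x≤x⊔ᶠy : ∀ {N} (x y : Fin N) → toℕ x ≤ toℕ (x ⊔ᶠ y)
x≤x⊔ᶠy x y with ⊔ᶠ-cases x y
... | inj₁ (x⊔y≡x , _) rewrite x⊔y≡x = ≤-refl
... | inj₂ (x⊔y≡y , x≤y) rewrite x⊔y≡y = x≤y

y≤x⊔ᶠy : ∀ {N} (x y : Fin N) → toℕ y ≤ toℕ (x ⊔ᶠ y)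
y≤x⊔ᶠy x y with ⊔ᶠ-cases x y
... | inj₁ (x⊔y≡x , y≤x) rewrite x⊔y≡x = y≤x
... | inj₂ (x⊔y≡y , _) rewrite x⊔y≡y = ≤-refl

AlignedEmbeddings : {k N : ℕ} → Seq k → Seq N → Set
AlignedEmbeddings σ π = (f h : Embedding σ π) →
  ∀ a → toℕ (map f a) ≤ toℕ (map h a) → π (map f a) ≤ π (map h a)

≤L∧pointwise-≥⇒≡ : {k N : ℕ} {σ : Seq k} {π : Seq N} {f h : Embedding σ π} →
                   f ≤L h → (∀ a → toℕ (map h a) ≤ toℕ (map f a)) → ∀ a → map f a ≡ map h a
≤L∧pointwise-≥⇒≡ (inj₁ f≡h) _ = f≡h
≤L∧pointwise-≥⇒≡ (inj₂ (c , _ , f<h)) h≤f = contradiction (h≤f c) (<⇒≱ f<h)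

module _ {k N : ℕ} {σ : Seq k} {π : Seq N}
         (σ-injective : Injective _≡_ _≡_ σ) (aligned : AlignedEmbeddings σ π) where

  module PointwiseMax (f h : Embedding σ π) where

    max : Fin k → Fin N
    max a = map f a ⊔ᶠ map h a

    π-≤-maxˡ : ∀ a → π (map f a) ≤ π (max a)
    π-≤-maxˡ a with ⊔ᶠ-cases (map f a) (map h a)
    ... | inj₁ (max≡f , _) rewrite max≡f = ≤-refl
    ... | inj₂ (max≡h , f≤h) rewrite max≡h = aligned f h a f≤h

    π-≤-maxʳ : ∀ a → π (map h a) ≤ π (max a)
    π-≤-maxʳ a with ⊔ᶠ-cases (map f a) (map h a)
    ... | inj₁ (max≡f , h≤f) rewrite max≡f = aligned h f a h≤f
    ... | inj₂ (max≡h , _) rewrite max≡h = ≤-refl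

    max-strict : ∀ a b → toℕ a < toℕ b → toℕ (max a) < toℕ (max b)
    max-strict a b a<b with ⊔ᶠ-cases (map f a) (map h a)
    ... | inj₁ (max≡f , _) rewrite max≡f = <-≤-trans (strict f a b a<b) (x≤x⊔ᶠy (map f b) (map h b))
    ... | inj₂ (max≡h , _) rewrite max≡h = <-≤-trans (strict h a b a<b) (y≤x⊔ᶠy (map f b) (map h b))

    max-preserves-< : ∀ a b → σ a < σ b → π (max a) < π (max b)
    max-preserves-< a b σa<σb with ⊔ᶠ-cases (map f a) (map h a)
    ... | inj₁ (max≡f , _) rewrite max≡f = <-≤-trans (embedding-< f σa<σb) (π-≤-maxˡ b)
    ... | inj₂ (max≡h , _) rewrite max≡h = <-≤-trans (embedding-< h σa<σb) (π-≤-maxʳ b)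

    max-reflects-< : ∀ a b → π (max a) < π (max b) → σ a < σ b
    max-reflects-< a b π<π with <-cmp (σ a) (σ b)
    ... | tri< σa<σb _ _ = σa<σb
    ... | tri≈ _ σa≡σb _ rewrite σ-injective σa≡σb = contradiction π<π (<-irrefl refl)
    ... | tri> _ _ σb<σa = contradiction π<π (<-asym (max-preserves-< b a σb<σa))

    embedding : Embedding σ π
    embedding = emb max max-strict λ a b → mk⇔ (max-preserves-< a b) (max-reflects-< a b)

    compatible : {t : ℕ} {τ : Seq t} {g : Embedding τ π} →
                 Compatible f g → Compatible h g → Compatible embedding g
    compatible f-compatible h-compatible a with ⊔ᶠ-cases (map f a) (map h a)
    ... | inj₁ (max≡f , _) rewrite max≡f = f-compatible a
    ... | inj₂ (max≡h , _) rewrite max≡h = h-compatible a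

  rightmost⇒pointwiseMax : {t : ℕ} {τ : Seq t} (g : Embedding τ π) (h : Embedding σ π) →
                           IsRightmost g h → IsPointwiseMax g h
  rightmost⇒pointwiseMax g h (h-compatible , h-rightmost) a = (h , h-compatible , refl) , bounded
    where
    bounded : (f : Embedding σ π) → Compatible f g → toℕ (map f a) ≤ toℕ (map h a)
    bounded f f-compatible = ≤-trans (x≤x⊔ᶠy (map f a) (map h a)) (≤-reflexive (cong toℕ (max≡h a)))
      where
      open PointwiseMax f h
      max≡h : ∀ b → max b ≡ map h b
      max≡h = ≤L∧pointwise-≥⇒≡ {f = embedding} {h = h}
                (h-rightmost embedding (compatible {g = g} f-compatible h-compatible))
                λ b → y≤x⊔ᶠy (map f b) (map h b)

module _ (n : ℕ) {m : ℕ} {L : Seq m} (L-injective : Injective _≡_ _≡_ L)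
         {i j : Fin m} (descent : InvDescent L i j)
         (first-top : ∀ p → toℕ p ≡ 0 → Top L i j p)
         (last-bottom : ∀ p → toℕ p ≡ m ∸ 1 → Bottom L i j p) where

  private
    position-≤ : (x : Fin (suc (suc (n + n)))) → toℕ x ≤ suc (n + n)
    position-≤ = toℕ≤pred[n]

    Lj<Li : L j < L i
    Lj<Li = ≤-reflexive (sym (proj₂ descent))

  top⊎bottom : ∀ p → Top L i j p ⊎ Bottom L i j p
  top⊎bottom p with L i ≤? L p
  ... | yes Li≤Lp = inj₁ Li≤Lp
  ... | no  Li≰Lp = inj₂ (s≤s⁻¹ (subst (L p <_) (proj₂ descent) (≰⇒> Li≰Lp)))

  top-bottom-disjoint : ∀ {p} → Top L i j p → Bottom L i j p → ⊥
  top-bottom-disjoint Li≤Lp Lp≤Lj = <⇒≱ Lj<Li (≤-trans Li≤Lp Lp≤Lj)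

  module _ (f : Embedding L (πseq n)) where

    private
      fi<fj : toℕ (map f i) < toℕ (map f j)
      fi<fj = strict f i j (proj₁ descent)

      π-descends : ¬ πseq n (map f i) ≤ πseq n (map f j)
      π-descends = <⇒≱ (embedding-< f Lj<Li)

      ascends-if-same-parity : SameParity (toℕ (map f i)) (toℕ (map f j)) →
                               πseq n (map f i) ≤ πseq n (map f j)
      ascends-if-same-parity same = piVal-mono-sameParity n same (<⇒≤ fi<fj) (position-≤ (map f j))

    descent-parity : Even (toℕ (map f i)) × Odd (toℕ (map f j))
    descent-parity with even⊎odd (toℕ (map f i)) | even⊎odd (toℕ (map f j))
    ... | inj₁ fi-even | inj₂ fj-odd  = fi-even , fj-odd
    ... | inj₁ fi-even | inj₁ fj-even =
      contradiction (ascends-if-same-parity (inj₁ (fi-even , fj-even))) π-descends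
    ... | inj₂ fi-odd  | inj₂ fj-odd  =
      contradiction (ascends-if-same-parity (inj₂ (fi-odd , fj-odd))) π-descends
    ... | inj₂ fi-odd  | inj₁ fj-even = contradiction πfi≤πfj π-descends
      where
      πfi≤πfj : πseq n (map f i) ≤ πseq n (map f j)
      πfi≤πfj = ≤-trans (piVal-odd-inner-≤ n fi-odd (<-≤-trans fi<fj (position-≤ (map f j))))
                        (≤-trans (n≤1+n n) (piVal-even-≥ n fj-even))

    top-even : ∀ {b} → Top L i j b → Even (toℕ (map f b))
    top-even {b} Li≤Lb with even⊎odd (toℕ (map f b))
    ... | inj₁ fb-even = fb-even
    ... | inj₂ fb-odd  = ⊥-elim (top-bottom-disjoint Li≤Lb (last-bottom b b-last))
      where
      π-large : suc n ≤ πseq n (map f b)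
      π-large = ≤-trans (piVal-even-≥ n (proj₁ descent-parity)) (embedding-≤ f L-injective Li≤Lb)

      fb-last : suc (toℕ (map f b)) ≡ suc (suc (n + n))
      fb-last = cong suc (≤-antisym (position-≤ (map f b))
                  (≮⇒≥ λ fb<last → <⇒≱ (s≤s (piVal-odd-inner-≤ n fb-odd fb<last)) π-large))

      b-last : toℕ b ≡ m ∸ 1
      b-last = cong (_∸ 1) (embedding-last f fb-last)

    bottom-odd : ∀ {b} → Bottom L i j b → Odd (toℕ (map f b))
    bottom-odd {b} Lb≤Lj with even⊎odd (toℕ (map f b))
    ... | inj₂ fb-odd  = fb-odd
    ... | inj₁ fb-even = ⊥-elim (top-bottom-disjoint (first-top b (embedding-zero f fb-first)) Lb≤Lj)
      where
      π-small : πseq n (map f b) ≤ 2 + n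
      π-small = ≤-trans (embedding-≤ f L-injective Lb≤Lj)
                        (piVal-odd-≤ n (proj₂ descent-parity) (position-≤ (map f j)))

      fb-first : toℕ (map f b) ≡ 0
      fb-first = n≤0⇒n≡0 (≮⇒≥ λ fb-pos → <⇒≱ (s≤s π-small) (piVal-even-pos-≥ n fb-even fb-pos))

  πseq-aligned : AlignedEmbeddings L (πseq n)
  πseq-aligned f h b fb≤hb = piVal-mono-sameParity n same-parity fb≤hb (position-≤ (map h b))
    where
    same-parity : SameParity (toℕ (map f b)) (toℕ (map h b))
    same-parity with top⊎bottom b
    ... | inj₁ top    = inj₁ (top-even f top , top-even h top)
    ... | inj₂ bottom = inj₂ (bottom-odd f bottom , bottom-odd h bottom)

⟦⟧-injective : {m : ℕ} (p : Perm m) → Injective _≡_ _≡_ ⟦ p ⟧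
⟦⟧-injective p e = proj₁ (bij p) (toℕ-injective e)

corollary21 : (n : ℕ) → 2 ≤ n →
    {m t : ℕ} (λp : Perm m) (τ : Perm t) →
    Proper n λp →
    ⟦ λp ⟧ ≼ ⟦ τ ⟧ → ⟦ τ ⟧ ≼ πseq n →
    (g : Embedding ⟦ τ ⟧ (πseq n)) →
    (h : Embedding ⟦ λp ⟧ (πseq n)) →
    IsRightmost g h →
    IsPointwiseMax g h
corollary21 n _ λp τ (_ , _ , i , j , descent , _ , top-ends , bottom-ends , _) _ _ =
  rightmost⇒pointwiseMax (⟦⟧-injective λp) aligned
  where
  aligned : AlignedEmbeddings ⟦ λp ⟧ (πseq n)
  aligned = πseq-aligned n (⟦⟧-injective λp) descent
              (λ p first → top-ends p (inj₁ first)) (λ p last → bottom-ends p (inj₂ last))
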